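{- Let $f(n)=n^2$. Then $\mathcal{L}_f\le_K\mathsf{nwd}$.
   Context: For ideals $\mathcal{I}$ on $A$, $\mathcal{J}$ on $B$ (countable sets), $\mathcal{I}\le_K\mathcal{J}$ means there is $\varphi:B\to A$ with $\varphi^{ -1}[C]\in\mathcal{J}$ for all $C\in\mathcal{I}$. $\mathsf{nwd}$ is the ideal on $2^{<\omega}$ of all $N$ such that for every $s\in 2^{<\omega}$ there is $t\supseteq s$ such that no element of $N$ extends $t$ (isomorphic to the ideal of nowhere dense subsets of $\mathbb{Q}$). For $f(n)=n^2$: $\mathcal{P}_f=\{s\in\omega^{<\omega}:\forall i\in\mathrm{dom}(s)\,(s(i)\le f(i))\}$; an $(n+1)$-slalom is a function $Z:\omega\to[\omega]^{<\omega}$ with $|Z(n)|\le n+1$ for all $n$; $\mathcal{C}_f(Z)=\{s\in\mathcal{P}_f:\forall i\in\mathrm{dom}(s)\,(s(i)\in Z(i))\}$; $\mathcal{L}_f$ is the ideal on $\mathcal{P}_f$ generated by all sets $\mathcal{C}_f(Z)$, $Z$ an $(n+1)$-slalom. -}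

module Defs where

open import Data.Nat using (ℕ; zero; suc; _*_; _≤_)
open import Data.Bool using (Bool)
open import Data.List using (List; []; _∷_; _++_; length)
open import Data.List.Membership.Propositional using (_∈_)
open import Data.List.Relation.Unary.Any using (Any)
open import Data.Product using (Σ; _×_)
open import Data.Unit using (⊤)
open import Relation.Nullary using (¬_)
open import Relation.Binary.PropositionalEquality using (_≡_)

IdealOn : Set → Set₁
IdealOn A = (A → Set) → Set

_≤K_ : {A B : Set} → IdealOn A → IdealOn B → Set₁
_≤K_ {A} {B} I J = Σ (B → A) λ φ → (C : A → Set) → I C → J (λ b → C (φ b))

_⊑_ : {X : Set} → List X → List X → Set
s ⊑ t = Σ _ λ r → t ≡ s ++ r

nwd : IdealOn (List Bool)
nwd N = (s : List Bool) → Σ (List Bool) λ t → (s ⊑ t) × ((u : List Bool) → t ⊑ u → ¬ N u)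

f : ℕ → ℕ
f n = n * n

BoundedFrom : ℕ → List ℕ → Set
BoundedFrom i [] = ⊤
BoundedFrom i (x ∷ xs) = (x ≤ f i) × BoundedFrom (suc i) xs

Pf : Set
Pf = Σ (List ℕ) (BoundedFrom 0)

Slalom : Set
Slalom = Σ (ℕ → List ℕ) λ Z → (n : ℕ) → length (Z n) ≤ suc n

InSlalomFrom : (ℕ → List ℕ) → ℕ → List ℕ → Set
InSlalomFrom Z i [] = ⊤
InSlalomFrom Z i (x ∷ xs) = (x ∈ Z i) × InSlalomFrom Z (suc i) xs

Cf : Slalom → Pf → Set
Cf Z s = InSlalomFrom (Σ.proj₁ Z) 0 (Σ.proj₁ s)

-- ℒ_f: ideal on 𝒫_f generated by the sets 𝒞_f(Z): X ∈ ℒ_f iff X is covered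
-- by finitely many 𝒞_f(Z).
Lf : IdealOn Pf
Lf X = Σ (List Slalom) λ Zs → (s : Pf) → X s → Any (λ Z → Cf Z s) Zs

-- Code a finite sequence of naturals as a binary string, each entry n becoming n ones
-- followed by a zero (truncated to n ≤ f i at coordinate i).  Given finitely many
-- (n+1)-slaloms Z₁ … Z_k and a string s, first close the entry that s may have left open,
-- then append k+1 zero entries so that the next coordinate I exceeds k; the slaloms cover
-- at most k(I+1) ≤ I² values at I, so some v ≤ I² = f I avoids all of them, and coding v
-- as the entry at I yields an extension of s none of whose extensions is coded into any
-- 𝒞_f(Zⱼ).  Hence the preimage of every set in ℒ_f is nowhere dense.
module Submission where

open import Defs
open import Data.Nat using (ℕ; zero; suc; z≤n; _+_; _*_; _≤_; _<_; _⊓_; _≟_)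
open import Data.Nat.Properties
open import Data.Bool using (Bool; true; false)
open import Data.Fin using (toℕ)
open import Data.Fin.Properties using (¬∀⟶∃¬; injective⇒≤; toℕ-injective; toℕ≤pred[n])
open import Data.List using (List; []; _∷_; _++_; length; replicate; concatMap; lookup)
open import Data.List.Properties using (length-++; ++-assoc; length-replicate)
open import Data.List.Membership.Propositional using (_∈_; _∉_)
open import Data.List.Membership.Propositional.Properties using (∈-concatMap⁺)
open import Data.List.Membership.DecPropositional _≟_ using (_∈?_)
open import Data.List.Relation.Unary.Any using (index)
import Data.List.Relation.Unary.Any as Any
open import Data.List.Relation.Unary.Any.Properties using (lookup-index)
open import Data.Product using (∃; _×_; _,_; proj₁; proj₂)
open import Data.Unit using (tt)
open import Relation.Nullary using (¬_)
open import Relation.Binary.PropositionalEquality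

∃-∉-≤ : ∀ m (xs : List ℕ) → length xs ≤ m → ∃ λ v → v ≤ m × v ∉ xs
∃-∉-≤ m xs len with ¬∀⟶∃¬ (suc m) (λ i → toℕ i ∈ xs) (λ i → toℕ i ∈? xs) not-all
  where
  not-all : ¬ (∀ i → toℕ i ∈ xs)
  not-all ∈xs = ≤⇒≯ len (injective⇒≤ index∘∈xs-injective)
    where
    index∘∈xs-injective : ∀ {i j} → index (∈xs i) ≡ index (∈xs j) → i ≡ j
    index∘∈xs-injective {i} {j} eq = toℕ-injective (begin
      toℕ i                       ≡⟨ lookup-index (∈xs i) ⟩
      lookup xs (index (∈xs i))   ≡⟨ cong (lookup xs) eq ⟩
      lookup xs (index (∈xs j))   ≡⟨ lookup-index (∈xs j) ⟨
      toℕ j                       ∎)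
      where open ≡-Reasoning
... | i , i∉xs = toℕ i , toℕ≤pred[n] i , i∉xs

length-concatMap-≤ : ∀ {A B : Set} (g : A → List B) {b} → (∀ x → length (g x) ≤ b) →
                     ∀ xs → length (concatMap g xs) ≤ length xs * b
length-concatMap-≤ g bound []       = z≤n
length-concatMap-≤ g bound (x ∷ xs) = begin
  length (g x ++ concatMap g xs)          ≡⟨ length-++ (g x) ⟩
  length (g x) + length (concatMap g xs)  ≤⟨ +-mono-≤ (bound x) (length-concatMap-≤ g bound xs) ⟩
  _ + length xs * _                       ∎
  where open ≤-Reasoning

m<n⇒m*[1+n]≤n*n : ∀ {m n} → m < n → m * suc n ≤ n * n
m<n⇒m*[1+n]≤n*n {m} {n} m<n = begin
  m * suc n    ≡⟨ *-suc m n ⟩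
  m + m * n    ≤⟨ +-monoˡ-≤ (m * n) (<⇒≤ m<n) ⟩
  suc m * n    ≤⟨ *-monoˡ-≤ n m<n ⟩
  n * n        ∎
  where open ≤-Reasoning

InSlalomFrom-++⁻ : ∀ Z i p {q} → InSlalomFrom Z i (p ++ q) → InSlalomFrom Z (i + length p) q
InSlalomFrom-++⁻ Z i []      {q} h       = subst (λ j → InSlalomFrom Z j q) (sym (+-identityʳ i)) h
InSlalomFrom-++⁻ Z i (x ∷ p) {q} (_ , h) =
  subst (λ j → InSlalomFrom Z j q) (sym (+-suc i (length p))) (InSlalomFrom-++⁻ Z (suc i) p h)

-- i is the current coordinate and a the number of ones read since the last zero; an
-- unterminated trailing run of ones is discarded.
decode : ℕ → ℕ → List Bool → List ℕ
decode i a []          = []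
decode i a (true ∷ u)  = decode i (suc a) u
decode i a (false ∷ u) = a ⊓ f i ∷ decode (suc i) 0 u

decode-bounded : ∀ i a u → BoundedFrom i (decode i a u)
decode-bounded i a []          = tt
decode-bounded i a (true ∷ u)  = decode-bounded i (suc a) u
decode-bounded i a (false ∷ u) = m⊓n≤n a (f i) , decode-bounded (suc i) 0 u

decode-++-false : ∀ i a w r → let p = decode i a (w ++ false ∷ []) in
                  decode i a (w ++ false ∷ r) ≡ p ++ decode (i + length p) 0 r
decode-++-false i a []          r = cong (λ j → a ⊓ f i ∷ decode j 0 r) (sym (+-comm i 1))
decode-++-false i a (true ∷ w)  r = decode-++-false i (suc a) w r
decode-++-false i a (false ∷ w) r = cong (a ⊓ f i ∷_) (begin
  decode (suc i) 0 (w ++ false ∷ r)      ≡⟨ decode-++-false (suc i) 0 w r ⟩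
  p ++ decode (suc i + length p) 0 r     ≡⟨ cong (λ j → p ++ decode j 0 r) (sym (+-suc i (length p))) ⟩
  p ++ decode (i + suc (length p)) 0 r   ∎)
  where
  open ≡-Reasoning
  p = decode (suc i) 0 (w ++ false ∷ [])

decode-falses : ∀ n i r → decode i 0 (replicate n false ++ r) ≡ replicate n 0 ++ decode (i + n) 0 r
decode-falses zero    i r = cong (λ j → decode j 0 r) (sym (+-identityʳ i))
decode-falses (suc n) i r = cong (0 ∷_) (trans (decode-falses n (suc i) r)
                                               (cong (λ j → replicate n 0 ++ decode j 0 r) (sym (+-suc i n))))

decode-trues : ∀ n i a r → decode i a (replicate n true ++ r) ≡ decode i (n + a) r
decode-trues zero    i a r = refl
decode-trues (suc n) i a r = trans (decode-trues n i (suc a) r) (cong (λ b → decode i b r) (+-suc n a))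

code : List Bool → Pf
code u = decode 0 0 u , decode-bounded 0 0 u

column : List Slalom → ℕ → List ℕ
column Zs i = concatMap (λ Z → proj₁ Z i) Zs

length-column-≤ : ∀ Zs i → length (column Zs i) ≤ length Zs * suc i
length-column-≤ Zs i = length-concatMap-≤ (λ Z → proj₁ Z i) (λ Z → proj₂ Z i) Zs

module Escape (Zs : List Slalom) (s : List Bool) where

  closed : List ℕ
  closed = decode 0 0 (s ++ false ∷ [])

  zeros : ℕ
  zeros = suc (length Zs)

  I : ℕ
  I = length closed + zeros

  fresh : ∃ λ v → v ≤ f I × v ∉ column Zs I
  fresh = ∃-∉-≤ (f I) (column Zs I)
            (≤-trans (length-column-≤ Zs I) (m<n⇒m*[1+n]≤n*n (m≤n+m zeros (length closed))))

  v : ℕ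
  v = proj₁ fresh

  padding : List Bool → List Bool
  padding r = false ∷ replicate zeros false ++ replicate v true ++ false ∷ r

  extension : List Bool
  extension = s ++ padding []

  extension-++ : ∀ r → extension ++ r ≡ s ++ padding r
  extension-++ r = begin
    (s ++ padding []) ++ r
      ≡⟨ ++-assoc s (padding []) r ⟩
    s ++ false ∷ (replicate zeros false ++ replicate v true ++ false ∷ []) ++ r
      ≡⟨ cong (λ x → s ++ false ∷ x) (++-assoc (replicate zeros false) _ r) ⟩
    s ++ false ∷ replicate zeros false ++ (replicate v true ++ false ∷ []) ++ r
      ≡⟨ cong (λ x → s ++ false ∷ replicate zeros false ++ x) (++-assoc (replicate v true) _ r) ⟩
    s ++ padding r
      ∎
    where open ≡-Reasoning

  decode-extension : ∀ r → decode 0 0 (extension ++ r) ≡ closed ++ replicate zeros 0 ++ v ∷ decode (suc I) 0 r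
  decode-extension r = begin
    decode 0 0 (extension ++ r)
      ≡⟨ cong (decode 0 0) (extension-++ r) ⟩
    decode 0 0 (s ++ padding r)
      ≡⟨ decode-++-false 0 0 s _ ⟩
    closed ++ decode (length closed) 0 (replicate zeros false ++ _)
      ≡⟨ cong (closed ++_) (decode-falses zeros (length closed) _) ⟩
    closed ++ replicate zeros 0 ++ decode I 0 (replicate v true ++ false ∷ r)
      ≡⟨ cong (λ x → closed ++ replicate zeros 0 ++ x) (decode-trues v I 0 (false ∷ r)) ⟩
    closed ++ replicate zeros 0 ++ (v + 0) ⊓ f I ∷ decode (suc I) 0 r
      ≡⟨ cong (λ x → closed ++ replicate zeros 0 ++ x ∷ decode (suc I) 0 r) v+0⊓fI≡v ⟩
    closed ++ replicate zeros 0 ++ v ∷ decode (suc I) 0 r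
      ∎
    where
    open ≡-Reasoning
    v+0⊓fI≡v : (v + 0) ⊓ f I ≡ v
    v+0⊓fI≡v = trans (cong (_⊓ f I) (+-identityʳ v)) (m≤n⇒m⊓n≡m (proj₁ (proj₂ fresh)))

  extension-forces : ∀ r (Z : Slalom) → Cf Z (code (extension ++ r)) → v ∈ proj₁ Z I
  extension-forces r (Z , _) h = subst (λ j → v ∈ Z j) (cong (length closed +_) (length-replicate zeros))
    (proj₁ (InSlalomFrom-++⁻ Z (length closed) (replicate zeros 0)
      (InSlalomFrom-++⁻ Z 0 closed (subst (InSlalomFrom Z 0) (decode-extension r) h))))

mainTheorem6 : Lf ≤K nwd
mainTheorem6 = code , λ _ (Zs , covers) s → let open Escape Zs s in
  extension , (padding [] , refl) , λ where
    _ (r , refl) u∈C → proj₂ (proj₂ fresh) (∈-concatMap⁺ (λ Z → proj₁ Z I)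
      (Any.map (λ {Z} → extension-forces r Z) (covers (code (extension ++ r)) u∈C)))
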